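{- Let $\ell,s$ be positive integers and $n_1,\dots,n_\ell,k_1,\dots,k_\ell$ positive integers with $s+1\leq n_1/k_1\leq n_2/k_2\leq \dots\leq n_\ell/k_\ell$. Let $V_1,\dots,V_\ell$ be pairwise disjoint sets with $|V_i|=n_i$, and let $\mathcal{F}\subseteq \sqcup_{i=1}^\ell \binom{V_i}{k_i}$. If $\nu(\mathcal{F})\leq s$, then \[ |\mathcal{F}|\le\frac{(s+1)k_1}{n_1} \prod_{i=1}^{\ell}\binom{n_i}{k_i}. \]
   Context: For pairwise disjoint finite sets $V_1,\dots,V_\ell$ and integers $k_1,\dots,k_\ell$, the direct product $\sqcup_{i=1}^\ell \binom{V_i}{k_i}$ is the collection of all subsets $F$ of $\bigcup_{i=1}^\ell V_i$ with $|F\cap V_i|=k_i$ for every $i$. The matching number $\nu(\mathcal{F})$ is the maximum number of pairwise disjoint members of $\mathcal{F}$. -}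

module Defs where

open import Data.Nat using (ℕ; suc; _*_)
open import Data.Fin using (Fin; zero; suc)
open import Data.Fin.Subset using (Subset; _∈_; _∩_; ∣_∣; Empty)
open import Data.Product using (∃; _×_)
open import Data.List using (List; length)
open import Data.List.Membership.Propositional renaming (_∈_ to _∈ₗ_)
open import Data.List.Relation.Unary.All using (All)
open import Data.List.Relation.Unary.AllPairs using (AllPairs)
open import Data.List.Relation.Unary.Unique.Propositional using (Unique)
open import Relation.Binary.PropositionalEquality using (_≡_; _≢_)

∏ : ∀ {m} → (Fin m → ℕ) → ℕ
∏ {ℕ.zero} f = 1
∏ {suc m} f = f zero * ∏ (λ i → f (suc i))

Disjoint : ∀ {N} → Subset N → Subset N → Set
Disjoint A B = Empty (A ∩ B)

PairwiseDisjoint : ∀ {ℓ N} → (Fin ℓ → Subset N) → Set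
PairwiseDisjoint V = ∀ i j → i ≢ j → Disjoint (V i) (V j)

InDirectProduct : ∀ {ℓ N} → (Fin ℓ → Subset N) → (Fin ℓ → ℕ) → Subset N → Set
InDirectProduct V k F =
  (∀ x → x ∈ F → ∃ λ i → x ∈ V i) × (∀ i → ∣ F ∩ V i ∣ ≡ k i)

-- a matching in the family 𝓕 (given as a duplicate-free list):
-- a list of distinct members of 𝓕 that are pairwise disjoint
IsMatching : ∀ {N} → List (Subset N) → List (Subset N) → Set
IsMatching 𝓕 M = All (_∈ₗ 𝓕) M × Unique M × AllPairs Disjoint M

MatchingNumberAtMost : ∀ {N} → List (Subset N) → ℕ → Set
MatchingNumberAtMost {N} 𝓕 s = ∀ (M : List (Subset N)) → IsMatching 𝓕 M → length M Data.Nat.≤ s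

-- Katona-style averaging. Let t = ⌊n₁/k₁⌋ ≥ s + 1, so that t pairwise disjoint members of the
-- direct product fit into V₁ ∪ ⋯ ∪ V_ℓ, and count the pairs (sequence G₁,…,G_t of pairwise
-- disjoint members, position j with G_j ∈ 𝓕). Swapping G₁ with G_j shows that every position
-- contributes |𝓕| times the number Z′ of ways to complete a fixed first member, so the count is
-- t |𝓕| Z′. The members of 𝓕 occurring in one sequence form a matching, so the count is also at
-- most s times the number ∏ C(nᵢ,kᵢ) Z′ of sequences. Hence t |𝓕| ≤ s ∏ C(nᵢ,kᵢ), and
-- n₁ < (t + 1) k₁ turns this into the bound.

module Submission where

open import Defs
open import Data.Nat using (ℕ; suc; _*_; _≤_)
open import Data.Nat.Combinatorics using (_C_)
open import Data.Fin using (Fin; zero) renaming (_≤_ to _≤ᶠ_)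
open import Data.Fin.Subset using (Subset; ∣_∣)
open import Data.List using (List; length)
open import Data.List.Relation.Unary.All using (All)
open import Data.List.Relation.Unary.Unique.Propositional using (Unique)
open import Relation.Binary.PropositionalEquality using (_≡_)

import Data.Bool.Properties as Bool
open import Data.Bool using (if_then_else_)
open import Data.Fin as Fin using (suc)
open import Data.Fin.Properties using (all?) renaming (suc-injective to Fin-suc-injective)
open import Data.Fin.Subset
  using (inside; outside; _∈_; _∉_; _⊆_; _∩_; _∪_; _─_; ⊥; Empty)
open import Data.Fin.Subset.Properties
  using ( _∈?_; _⊆?_; out⊆-⇔; in⊆in-⇔; drop-∷-⊆; p─q⊆p; x∈p∧x∉q⇒x∈p─q; x∈p∩q⁺; x∈p∩q⁻; p∩q⊆q
        ; x∈p∪q⁻; p⊆p∪q; q⊆p∪q; ∉⊥; ⊆-antisym; Empty-unique; ∣⊥∣≡0)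
open import Data.List using ([]; _∷_)
open import Data.List.Membership.Propositional using () renaming (_∈_ to _∈ₗ_)
open import Data.List.Relation.Unary.All as All using ([]; _∷_)
open import Data.List.Relation.Unary.All.Properties using (All¬⇒¬Any)
open import Data.List.Relation.Unary.AllPairs using ([]; _∷_)
import Data.List.Relation.Unary.Any as Any
open import Data.Nat using (zero; _+_; _∸_; _<_; z≤n; s≤s; s≤s⁻¹; _≟_; NonZero; >-nonZero)
open import Data.Nat.Combinatorics using (nCk+nC[k+1]≡[n+1]C[k+1])
open import Data.Nat.DivMod using (_/_; _%_; m≡m%n+[m/n]*n; m%n<n; m/n*n≤m; /-monoˡ-≤; m*n/n≡m)
open import Data.Nat.Properties
open import Data.Nat.Tactic.RingSolver using (solve-∀)
open import Data.Product using (∃; _×_; _,_; proj₁; proj₂; uncurry)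
import Data.Product as Product
open import Data.Product.Function.NonDependent.Propositional using (_×-⇔_)
open import Data.Sum using ([_,_])
open import Data.Vec using ([]; _∷_; tail; here; there)
open import Data.Vec.Properties using (≡-dec)
open import Function using (_∘_; id; _⇔_; mk⇔; Equivalence)
import Function.Properties.Equivalence as ⇔
open import Relation.Binary using (DecidableEquality)
open import Relation.Binary.PropositionalEquality
  using (refl; sym; trans; cong; cong₂; subst; subst₂; _≢_; module ≡-Reasoning)
open import Relation.Nullary using (Dec; does; yes; no; _×-dec_; ¬_; contradiction)
open import Relation.Nullary.Decidable using (does-⇔)
open import Relation.Unary using (Decidable)

open import Algebra.Properties.CommutativeSemigroup +-commutativeSemigroup
  using () renaming (interchange to +-interchange)
open import Algebra.Properties.CommutativeSemigroup *-commutativeSemigroup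
  using (x∙yz≈y∙xz; x∙yz≈xz∙y; xy∙z≈xz∙y)

𝟙 : ∀ {a} {A : Set a} → Dec A → ℕ
𝟙 a? = if does a? then 1 else 0

𝟙-yes : ∀ {a} {A : Set a} (a? : Dec A) → A → 𝟙 a? ≡ 1
𝟙-yes (yes _) a = refl
𝟙-yes (no ¬a) a = contradiction a ¬a

𝟙-no : ∀ {a} {A : Set a} (a? : Dec A) → ¬ A → 𝟙 a? ≡ 0
𝟙-no (yes a) ¬a = contradiction a ¬a
𝟙-no (no _)  ¬a = refl

𝟙-⇔ : ∀ {a b} {A : Set a} {B : Set b} → A ⇔ B → (a? : Dec A) (b? : Dec B) → 𝟙 a? ≡ 𝟙 b?
𝟙-⇔ A⇔B a? b? = cong (λ x → if x then 1 else 0) (does-⇔ A⇔B a? b?)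

𝟙-×-dec : ∀ {a b} {A : Set a} {B : Set b} (a? : Dec A) (b? : Dec B) → 𝟙 (a? ×-dec b?) ≡ 𝟙 a? * 𝟙 b?
𝟙-×-dec (yes _) b? = sym (+-identityʳ (𝟙 b?))
𝟙-×-dec (no _)  b? = refl

𝟙-*-cong : ∀ {a} {A : Set a} (a? : Dec A) {x y} → (A → x ≡ y) → 𝟙 a? * x ≡ 𝟙 a? * y
𝟙-*-cong (yes a) x≡y = cong (1 *_) (x≡y a)
𝟙-*-cong (no _)  x≡y = refl

𝟙-*-mono : ∀ {a} {A : Set a} (a? : Dec A) {x y} → (A → x ≤ y) → 𝟙 a? * x ≤ 𝟙 a? * y
𝟙-*-mono (yes a) x≤y = *-monoʳ-≤ 1 (x≤y a)
𝟙-*-mono (no _)  x≤y = z≤n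

∀-⇔ : ∀ {p} {P Q : Fin p → Set} → (∀ i → P i ⇔ Q i) → (∀ i → P i) ⇔ (∀ i → Q i)
∀-⇔ P⇔Q = mk⇔ (λ P i → Equivalence.to (P⇔Q i) (P i)) (λ Q i → Equivalence.from (P⇔Q i) (Q i))

≡-⇔ : ∀ {a b c : ℕ} → a ≡ b → (a ≡ c) ⇔ (b ≡ c)
≡-⇔ a≡b = mk⇔ (trans (sym a≡b)) (trans a≡b)

∏-cong : ∀ {p} {f g : Fin p → ℕ} → (∀ i → f i ≡ g i) → ∏ f ≡ ∏ g
∏-cong {zero}  f≗g = refl
∏-cong {suc p} f≗g = cong₂ _*_ (f≗g zero) (∏-cong (f≗g ∘ suc))

∏-pos : ∀ {p} (f : Fin p → ℕ) → (∀ i → 0 < f i) → 0 < ∏ f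
∏-pos {zero}  f f>0 = s≤s z≤n
∏-pos {suc p} f f>0 = *-mono-≤ (f>0 zero) (∏-pos (f ∘ suc) (f>0 ∘ suc))

∏-split : ∀ {p} (f g h : Fin p → ℕ) i₀ → f i₀ ≡ g i₀ + h i₀ →
          (∀ j → j ≢ i₀ → f j ≡ g j) → (∀ j → j ≢ i₀ → f j ≡ h j) →
          ∏ f ≡ ∏ g + ∏ h
∏-split {suc p} f g h zero f≡g+h f≡g f≡h = begin
  f zero * ∏ (f ∘ suc)                         ≡⟨ cong (_* ∏ (f ∘ suc)) f≡g+h ⟩
  (g zero + h zero) * ∏ (f ∘ suc)              ≡⟨ *-distribʳ-+ (∏ (f ∘ suc)) (g zero) (h zero) ⟩
  g zero * ∏ (f ∘ suc) + h zero * ∏ (f ∘ suc)  ≡⟨ cong₂ _+_ (cong (g zero *_) (∏-cong (λ j → f≡g (suc j) λ ())))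
                                                             (cong (h zero *_) (∏-cong (λ j → f≡h (suc j) λ ()))) ⟩
  g zero * ∏ (g ∘ suc) + h zero * ∏ (h ∘ suc)  ∎
  where open ≡-Reasoning
∏-split {suc p} f g h (suc i₀) f≡g+h f≡g f≡h = begin
  f zero * ∏ (f ∘ suc)                         ≡⟨ cong (f zero *_) (∏-split (f ∘ suc) (g ∘ suc) (h ∘ suc) i₀ f≡g+h
                                                    (λ j j≢i₀ → f≡g (suc j) (j≢i₀ ∘ Fin-suc-injective))
                                                    (λ j j≢i₀ → f≡h (suc j) (j≢i₀ ∘ Fin-suc-injective))) ⟩
  f zero * (∏ (g ∘ suc) + ∏ (h ∘ suc))         ≡⟨ *-distribˡ-+ (f zero) (∏ (g ∘ suc)) (∏ (h ∘ suc)) ⟩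
  f zero * ∏ (g ∘ suc) + f zero * ∏ (h ∘ suc)  ≡⟨ cong₂ _+_ (cong (_* ∏ (g ∘ suc)) (f≡g zero λ ()))
                                                             (cong (_* ∏ (h ∘ suc)) (f≡h zero λ ())) ⟩
  g zero * ∏ (g ∘ suc) + h zero * ∏ (h ∘ suc)  ∎
  where open ≡-Reasoning

𝟙-all? : ∀ {p ℓ} {P : Fin p → Set ℓ} (P? : Decidable P) → 𝟙 (all? P?) ≡ ∏ (λ i → 𝟙 (P? i))
𝟙-all? {zero}            P? = refl
𝟙-all? {suc p} {P = P} P? = begin
  𝟙 (all? P?)                             ≡⟨ 𝟙-⇔ ∀-suc⇔ (all? P?) (P? zero ×-dec all? (P? ∘ suc)) ⟩
  𝟙 (P? zero ×-dec all? (P? ∘ suc))       ≡⟨ 𝟙-×-dec (P? zero) (all? (P? ∘ suc)) ⟩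
  𝟙 (P? zero) * 𝟙 (all? (P? ∘ suc))       ≡⟨ cong (𝟙 (P? zero) *_) (𝟙-all? (P? ∘ suc)) ⟩
  𝟙 (P? zero) * ∏ (λ i → 𝟙 (P? (suc i)))  ∎
  where
  open ≡-Reasoning
  ∀-suc⇔ : (∀ i → P i) ⇔ (P zero × (∀ i → P (suc i)))
  ∀-suc⇔ = mk⇔ (λ ∀P → ∀P zero , ∀P ∘ suc) (λ { (P₀ , P₊) zero → P₀ ; (P₀ , P₊) (suc i) → P₊ i })

C-pos : ∀ {n k} → k ≤ n → 0 < n C k
C-pos {n}     {zero}  _         = s≤s z≤n
C-pos {suc n} {suc k} (s≤s k≤n) =
  subst (0 <_) (nCk+nC[k+1]≡[n+1]C[k+1] n k) (≤-trans (C-pos k≤n) (m≤m+n (n C k) (n C suc k)))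

∑ₛ : ∀ {N} → (Subset N → ℕ) → ℕ
∑ₛ {zero}  f = f []
∑ₛ {suc N} f = ∑ₛ (f ∘ (outside ∷_)) + ∑ₛ (f ∘ (inside ∷_))

∑ₛ-cong : ∀ {N} {f g : Subset N → ℕ} → (∀ G → f G ≡ g G) → ∑ₛ f ≡ ∑ₛ g
∑ₛ-cong {zero}  f≗g = f≗g []
∑ₛ-cong {suc N} f≗g = cong₂ _+_ (∑ₛ-cong (f≗g ∘ (outside ∷_))) (∑ₛ-cong (f≗g ∘ (inside ∷_)))

∑ₛ-mono-≤ : ∀ {N} {f g : Subset N → ℕ} → (∀ G → f G ≤ g G) → ∑ₛ f ≤ ∑ₛ g
∑ₛ-mono-≤ {zero}  f≤g = f≤g []
∑ₛ-mono-≤ {suc N} f≤g = +-mono-≤ (∑ₛ-mono-≤ (f≤g ∘ (outside ∷_))) (∑ₛ-mono-≤ (f≤g ∘ (inside ∷_)))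

∑ₛ-zero : ∀ {N} → ∑ₛ {N} (λ _ → 0) ≡ 0
∑ₛ-zero {zero}  = refl
∑ₛ-zero {suc N} = cong₂ _+_ (∑ₛ-zero {N}) (∑ₛ-zero {N})

∑ₛ-distrib-+ : ∀ {N} (f g : Subset N → ℕ) → ∑ₛ (λ G → f G + g G) ≡ ∑ₛ f + ∑ₛ g
∑ₛ-distrib-+ {zero}  f g = refl
∑ₛ-distrib-+ {suc N} f g = begin
  ∑ₛ (λ G → f (outside ∷ G) + g (outside ∷ G)) + ∑ₛ (λ G → f (inside ∷ G) + g (inside ∷ G))
    ≡⟨ cong₂ _+_ (∑ₛ-distrib-+ (f ∘ (outside ∷_)) (g ∘ (outside ∷_)))
                 (∑ₛ-distrib-+ (f ∘ (inside ∷_)) (g ∘ (inside ∷_))) ⟩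
  (∑ₛ (f ∘ (outside ∷_)) + ∑ₛ (g ∘ (outside ∷_))) + (∑ₛ (f ∘ (inside ∷_)) + ∑ₛ (g ∘ (inside ∷_)))
    ≡⟨ +-interchange (∑ₛ (f ∘ (outside ∷_))) (∑ₛ (g ∘ (outside ∷_))) (∑ₛ (f ∘ (inside ∷_))) (∑ₛ (g ∘ (inside ∷_))) ⟩
  (∑ₛ (f ∘ (outside ∷_)) + ∑ₛ (f ∘ (inside ∷_))) + (∑ₛ (g ∘ (outside ∷_)) + ∑ₛ (g ∘ (inside ∷_)))
    ∎
  where open ≡-Reasoning

∑ₛ-*ˡ : ∀ {N} c (f : Subset N → ℕ) → ∑ₛ (λ G → c * f G) ≡ c * ∑ₛ f
∑ₛ-*ˡ {zero}  c f = refl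
∑ₛ-*ˡ {suc N} c f = trans (cong₂ _+_ (∑ₛ-*ˡ c (f ∘ (outside ∷_))) (∑ₛ-*ˡ c (f ∘ (inside ∷_))))
                          (sym (*-distribˡ-+ c _ _))

∑ₛ-*ʳ : ∀ {N} (f : Subset N → ℕ) c → ∑ₛ (λ G → f G * c) ≡ ∑ₛ f * c
∑ₛ-*ʳ f c = trans (∑ₛ-cong (λ G → *-comm (f G) c)) (trans (∑ₛ-*ˡ c f) (*-comm c (∑ₛ f)))

∑ₛ-comm : ∀ {N M} (f : Subset N → Subset M → ℕ) →
          ∑ₛ (λ G → ∑ₛ (λ H → f G H)) ≡ ∑ₛ (λ H → ∑ₛ (λ G → f G H))
∑ₛ-comm {zero}  f = refl
∑ₛ-comm {suc N} f =
  trans (cong₂ _+_ (∑ₛ-comm (f ∘ (outside ∷_))) (∑ₛ-comm (f ∘ (inside ∷_))))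
        (sym (∑ₛ-distrib-+ (λ H → ∑ₛ (λ G → f (outside ∷ G) H)) (λ H → ∑ₛ (λ G → f (inside ∷ G) H))))

infix 4 _≟ₛ_ _∈ₗ?_

_≟ₛ_ : ∀ {N} → DecidableEquality (Subset N)
_≟ₛ_ = ≡-dec Bool._≟_

_∈ₗ?_ : ∀ {N} (G : Subset N) (L : List (Subset N)) → Dec (G ∈ₗ L)
G ∈ₗ? L = Any.any? (G ≟ₛ_) L

∑ₛ-𝟙-≟ : ∀ {N} (A : Subset N) → ∑ₛ (λ G → 𝟙 (G ≟ₛ A)) ≡ 1
∑ₛ-𝟙-≟ []                    = refl
∑ₛ-𝟙-≟ {suc N} (outside ∷ A) = cong₂ _+_ (∑ₛ-𝟙-≟ A) (∑ₛ-zero {N})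
∑ₛ-𝟙-≟ {suc N} (inside ∷ A)  = cong₂ _+_ (∑ₛ-zero {N}) (∑ₛ-𝟙-≟ A)

∑ₛ-𝟙-∈ : ∀ {N} (L : List (Subset N)) → Unique L → ∑ₛ (λ G → 𝟙 (G ∈ₗ? L)) ≡ length L
∑ₛ-𝟙-∈ {N} []      []             = ∑ₛ-zero {N}
∑ₛ-𝟙-∈     (A ∷ L) (A∉L ∷ unique) = begin
  ∑ₛ (λ G → 𝟙 (G ∈ₗ? A ∷ L))                      ≡⟨ ∑ₛ-cong 𝟙-∈-∷ ⟩
  ∑ₛ (λ G → 𝟙 (G ≟ₛ A) + 𝟙 (G ∈ₗ? L))             ≡⟨ ∑ₛ-distrib-+ (λ G → 𝟙 (G ≟ₛ A)) (λ G → 𝟙 (G ∈ₗ? L)) ⟩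
  ∑ₛ (λ G → 𝟙 (G ≟ₛ A)) + ∑ₛ (λ G → 𝟙 (G ∈ₗ? L))  ≡⟨ cong₂ _+_ (∑ₛ-𝟙-≟ A) (∑ₛ-𝟙-∈ L unique) ⟩
  suc (length L)                                  ∎
  where
  open ≡-Reasoning
  𝟙-∈-∷ : ∀ G → 𝟙 (G ∈ₗ? A ∷ L) ≡ 𝟙 (G ≟ₛ A) + 𝟙 (G ∈ₗ? L)
  𝟙-∈-∷ G with G ≟ₛ A
  ... | yes refl = sym (cong suc (𝟙-no (G ∈ₗ? L) (All¬⇒¬Any A∉L)))
  ... | no _     = refl

x∈p─q⇒x∉q : ∀ {N} {x : Fin N} (p q : Subset N) → x ∈ p ─ q → x ∉ q
x∈p─q⇒x∉q (_ ∷ p) (outside ∷ q) here          ()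
x∈p─q⇒x∉q (_ ∷ p) (inside  ∷ q) (there x∈p─q) (there x∈q) = x∈p─q⇒x∉q p q x∈p─q x∈q
x∈p─q⇒x∉q (_ ∷ p) (outside ∷ q) (there x∈p─q) (there x∈q) = x∈p─q⇒x∉q p q x∈p─q x∈q

Disjoint-sym : ∀ {N} {G H : Subset N} → Disjoint G H → Disjoint H G
Disjoint-sym {G = G} {H} G∩H=∅ (x , x∈H∩G) =
  G∩H=∅ (x , x∈p∩q⁺ (proj₂ (x∈p∩q⁻ H G x∈H∩G) , proj₁ (x∈p∩q⁻ H G x∈H∩G)))

⊆-─⇔ : ∀ {N} {H W G : Subset N} → H ⊆ W ─ G ⇔ (H ⊆ W × Disjoint G H)
⊆-─⇔ {H = H} {W} {G} = mk⇔
  (λ H⊆W─G → (λ {x} x∈H → p─q⊆p W G (H⊆W─G x∈H)) ,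
             λ { (x , x∈G∩H) → x∈p─q⇒x∉q W G (H⊆W─G (proj₂ (x∈p∩q⁻ G H x∈G∩H))) (proj₁ (x∈p∩q⁻ G H x∈G∩H)) })
  (λ { (H⊆W , G∩H=∅) {x} x∈H → x∈p∧x∉q⇒x∈p─q (H⊆W x∈H) (λ x∈G → G∩H=∅ (x , x∈p∩q⁺ (x∈G , x∈H))) })

∣─∩∣+∣∩∣ : ∀ {N} {G W : Subset N} (X : Subset N) → G ⊆ W → ∣ (W ─ G) ∩ X ∣ + ∣ G ∩ X ∣ ≡ ∣ W ∩ X ∣
∣─∩∣+∣∩∣ {G = []}          {[]}          []            G⊆W = refl
∣─∩∣+∣∩∣ {G = outside ∷ G} {outside ∷ W} (x       ∷ X) G⊆W = ∣─∩∣+∣∩∣ X (drop-∷-⊆ G⊆W)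
∣─∩∣+∣∩∣ {G = outside ∷ G} {inside  ∷ W} (outside ∷ X) G⊆W = ∣─∩∣+∣∩∣ X (drop-∷-⊆ G⊆W)
∣─∩∣+∣∩∣ {G = outside ∷ G} {inside  ∷ W} (inside  ∷ X) G⊆W = cong suc (∣─∩∣+∣∩∣ X (drop-∷-⊆ G⊆W))
∣─∩∣+∣∩∣ {G = inside  ∷ G} {inside  ∷ W} (outside ∷ X) G⊆W = ∣─∩∣+∣∩∣ X (drop-∷-⊆ G⊆W)
∣─∩∣+∣∩∣ {G = inside  ∷ G} {inside  ∷ W} (inside  ∷ X) G⊆W =
  trans (+-suc _ _) (cong suc (∣─∩∣+∣∩∣ X (drop-∷-⊆ G⊆W)))
∣─∩∣+∣∩∣ {G = inside  ∷ G} {outside ∷ W} X G⊆W with () ← G⊆W here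

∣outside∷∩∣ : ∀ {N} (G : Subset N) (v : Subset (suc N)) → ∣ (outside ∷ G) ∩ v ∣ ≡ ∣ G ∩ tail v ∣
∣outside∷∩∣ G (_ ∷ v) = refl

∣inside∷∩∣ : ∀ {N} (G : Subset N) (v : Subset (suc N)) → ∣ (inside ∷ G) ∩ v ∣ ≡ 𝟙 (zero ∈? v) + ∣ G ∩ tail v ∣
∣inside∷∩∣ G (outside ∷ v) = refl
∣inside∷∩∣ G (inside  ∷ v) = refl

∣[]∩v∣≡0 : ∀ (v : Subset 0) → ∣ [] ∩ v ∣ ≡ 0
∣[]∩v∣≡0 [] = refl

𝟙[0≟d]≡0Cd : ∀ d → 𝟙 (0 ≟ d) ≡ 0 C d
𝟙[0≟d]≡0Cd zero    = refl
𝟙[0≟d]≡0Cd (suc d) = refl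

⋃ᶠ : ∀ {p N} → (Fin p → Subset N) → Subset N
⋃ᶠ {zero}  V = ⊥
⋃ᶠ {suc p} V = V zero ∪ ⋃ᶠ (V ∘ suc)

⊆-⋃ᶠ : ∀ {p N} (V : Fin p → Subset N) i → V i ⊆ ⋃ᶠ V
⊆-⋃ᶠ V zero    = p⊆p∪q _
⊆-⋃ᶠ V (suc i) = q⊆p∪q (V zero) _ ∘ ⊆-⋃ᶠ (V ∘ suc) i

⋃ᶠ-∩ : ∀ {p N} (V : Fin p → Subset N) i → ⋃ᶠ V ∩ V i ≡ V i
⋃ᶠ-∩ V i = ⊆-antisym (p∩q⊆q _ _) (λ x∈Vi → x∈p∩q⁺ (⊆-⋃ᶠ V i x∈Vi , x∈Vi))

Covered : ∀ {p N} → (Fin p → Subset N) → Subset N → Set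
Covered V G = ∀ x → x ∈ G → ∃ λ i → x ∈ V i

Covered-⋃ᶠ : ∀ {p N} (V : Fin p → Subset N) → Covered V (⋃ᶠ V)
Covered-⋃ᶠ {zero}  V x x∈⊥ = contradiction x∈⊥ ∉⊥
Covered-⋃ᶠ {suc p} V x x∈⋃ =
  [ (λ x∈V₀ → zero , x∈V₀) , (λ x∈⋃V₊ → Product.map suc id (Covered-⋃ᶠ (V ∘ suc) x x∈⋃V₊)) ] (x∈p∪q⁻ (V zero) _ x∈⋃)

Covered⇒⊆⋃ᶠ : ∀ {p N} (V : Fin p → Subset N) {G} → Covered V G → G ⊆ ⋃ᶠ V
Covered⇒⊆⋃ᶠ V covered {x} x∈G = let i , x∈Vi = covered x x∈G in ⊆-⋃ᶠ V i x∈Vi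

Covered-⊆ : ∀ {p N} {V : Fin p → Subset N} {G W} → G ⊆ W → Covered V W → Covered V G
Covered-⊆ G⊆W covered x x∈G = covered x (G⊆W x∈G)

Covered-tail : ∀ {p N} {V : Fin p → Subset (suc N)} {w W} → Covered V (w ∷ W) → Covered (tail ∘ V) W
Covered-tail {V = V} covered x x∈W with covered (suc x) (there x∈W)
... | i , sx∈Vi = i , ∈-tail (V i) sx∈Vi
  where
  ∈-tail : ∀ v → suc x ∈ v → x ∈ tail v
  ∈-tail (_ ∷ v) (there x∈v) = x∈v

PairwiseDisjoint-tail : ∀ {p N} {V : Fin p → Subset (suc N)} → PairwiseDisjoint V → PairwiseDisjoint (tail ∘ V)
PairwiseDisjoint-tail {V = V} disjoint i j i≢j (x , x∈Vi∩Vj) = disjoint i j i≢j (suc x , suc-∈ (V i) (V j) x∈Vi∩Vj)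
  where
  suc-∈ : ∀ u v → x ∈ tail u ∩ tail v → suc x ∈ u ∩ v
  suc-∈ (_ ∷ u) (_ ∷ v) x∈u∩v = there x∈u∩v

HasSizes : ∀ {p N} → (Fin p → Subset N) → (Fin p → ℕ) → Subset N → Set
HasSizes V d G = ∀ i → ∣ G ∩ V i ∣ ≡ d i

-- Covering by V is not part of an edge: edges are only ever taken inside a covered set W.
Edge : ∀ {p N} → (Fin p → Subset N) → (Fin p → ℕ) → Subset N → Subset N → Set
Edge V d W G = G ⊆ W × HasSizes V d G

edge? : ∀ {p N} (V : Fin p → Subset N) (d : Fin p → ℕ) (W G : Subset N) → Dec (Edge V d W G)
edge? V d W G = G ⊆? W ×-dec all? (λ i → ∣ G ∩ V i ∣ ≟ d i)

-- The demands left for G once the point zero is in G.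
remaining : ∀ {p N} → (Fin p → Subset (suc N)) → (Fin p → ℕ) → Fin p → ℕ
remaining V d i = d i ∸ 𝟙 (zero ∈? V i)

module _ {p N} {V : Fin p → Subset (suc N)} (disjoint : PairwiseDisjoint V) {i₀} (0∈Vi₀ : zero ∈ V i₀)
         (W : Subset N) where

  private
    m : Fin p → ℕ
    m i = ∣ W ∩ tail (V i) ∣

  0∈V⇒≡i₀ : ∀ {j} → zero ∈ V j → j ≡ i₀
  0∈V⇒≡i₀ {j} 0∈Vj with j Fin.≟ i₀
  ... | yes j≡i₀ = j≡i₀
  ... | no  j≢i₀ = contradiction (zero , x∈p∩q⁺ (0∈Vj , 0∈Vi₀)) (disjoint j i₀ j≢i₀)

  𝟙[0∈V]≡0 : ∀ j → j ≢ i₀ → 𝟙 (zero ∈? V j) ≡ 0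
  𝟙[0∈V]≡0 j j≢i₀ = 𝟙-no (zero ∈? V j) (j≢i₀ ∘ 0∈V⇒≡i₀)

  ∑ₛ-edge-inside-zero : ∀ d → d i₀ ≡ 0 →
    ∏ (λ i → m i C d i) + ∑ₛ (λ G → 𝟙 (edge? V d (inside ∷ W) (inside ∷ G))) ≡ ∏ (λ i → (𝟙 (zero ∈? V i) + m i) C d i)
  ∑ₛ-edge-inside-zero d d₀≡0 = begin
    ∏ (λ i → m i C d i) + ∑ₛ (λ G → 𝟙 (edge? V d (inside ∷ W) (inside ∷ G)))
      ≡⟨ cong (∏ (λ i → m i C d i) +_) (trans (∑ₛ-cong no-edge) (∑ₛ-zero {N})) ⟩
    ∏ (λ i → m i C d i) + 0                  ≡⟨ +-identityʳ _ ⟩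
    ∏ (λ i → m i C d i)                      ≡⟨ ∏-cong C-unchanged ⟩
    ∏ (λ i → (𝟙 (zero ∈? V i) + m i) C d i)  ∎
    where
    open ≡-Reasoning
    no-edge : ∀ G → 𝟙 (edge? V d (inside ∷ W) (inside ∷ G)) ≡ 0
    no-edge G = 𝟙-no (edge? V d (inside ∷ W) (inside ∷ G)) λ (_ , sizes) →
      1+n≢0 (trans (cong (_+ ∣ G ∩ tail (V i₀) ∣) (sym (𝟙-yes (zero ∈? V i₀) 0∈Vi₀)))
                   (trans (sym (∣inside∷∩∣ G (V i₀))) (trans (sizes i₀) d₀≡0)))
    C-unchanged : ∀ i → m i C d i ≡ (𝟙 (zero ∈? V i) + m i) C d i
    C-unchanged i with i Fin.≟ i₀
    ... | yes refl rewrite d₀≡0 = refl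
    ... | no i≢i₀  = cong (λ b → (b + m i) C d i) (sym (𝟙[0∈V]≡0 i i≢i₀))

  module _ (d : Fin p → ℕ) {e} (d₀≡1+e : d i₀ ≡ suc e) where

    private
      d′ = remaining V d

    ∑ₛ-edge-inside≡∑ₛ-edge-remaining :
      ∑ₛ (λ G → 𝟙 (edge? V d (inside ∷ W) (inside ∷ G))) ≡ ∑ₛ (λ G → 𝟙 (edge? (tail ∘ V) d′ W G))
    ∑ₛ-edge-inside≡∑ₛ-edge-remaining =
      ∑ₛ-cong (λ G → 𝟙-⇔ (edge⇔ G) (edge? V d (inside ∷ W) (inside ∷ G)) (edge? (tail ∘ V) d′ W G))
      where
      shift : ∀ G i → (𝟙 (zero ∈? V i) + ∣ G ∩ tail (V i) ∣ ≡ d i) ⇔ (∣ G ∩ tail (V i) ∣ ≡ d′ i)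
      shift G i with zero ∈? V i
      ... | no _     = ⇔.refl
      ... | yes 0∈Vi with refl ← 0∈V⇒≡i₀ 0∈Vi rewrite d₀≡1+e = mk⇔ suc-injective (cong suc)
      edge⇔ : ∀ G → Edge V d (inside ∷ W) (inside ∷ G) ⇔ Edge (tail ∘ V) d′ W G
      edge⇔ G = ⇔.sym in⊆in-⇔ ×-⇔ ∀-⇔ (λ i → ⇔.trans (≡-⇔ (∣inside∷∩∣ G (V i))) (shift G i))

    ∏-C-pascal : ∏ (λ i → m i C d i) + ∏ (λ i → m i C d′ i) ≡ ∏ (λ i → (𝟙 (zero ∈? V i) + m i) C d i)
    ∏-C-pascal = sym (∏-split (λ i → (𝟙 (zero ∈? V i) + m i) C d i) (λ i → m i C d i) (λ i → m i C d′ i) i₀ pascal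
      (λ j j≢i₀ → cong (λ b → (b + m j) C d j) (𝟙[0∈V]≡0 j j≢i₀))
      (λ j j≢i₀ → trans (cong (λ b → (b + m j) C d j) (𝟙[0∈V]≡0 j j≢i₀))
                        (cong (λ b → m j C (d j ∸ b)) (sym (𝟙[0∈V]≡0 j j≢i₀)))))
      where
      open ≡-Reasoning
      pascal : (𝟙 (zero ∈? V i₀) + m i₀) C d i₀ ≡ m i₀ C d i₀ + m i₀ C d′ i₀
      pascal = begin
        (𝟙 (zero ∈? V i₀) + m i₀) C d i₀  ≡⟨ cong₂ (λ b c → (b + m i₀) C c) (𝟙-yes (zero ∈? V i₀) 0∈Vi₀) d₀≡1+e ⟩
        suc (m i₀) C suc e                ≡⟨ nCk+nC[k+1]≡[n+1]C[k+1] (m i₀) e ⟨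
        m i₀ C e + m i₀ C suc e           ≡⟨ +-comm (m i₀ C e) _ ⟩
        m i₀ C suc e + m i₀ C e           ≡⟨ cong₂ (λ a b → m i₀ C a + m i₀ C b) (sym d₀≡1+e)
                                                   (sym (cong₂ _∸_ d₀≡1+e (𝟙-yes (zero ∈? V i₀) 0∈Vi₀))) ⟩
        m i₀ C d i₀ + m i₀ C d′ i₀        ∎

  ∑ₛ-edge-inside : ∀ d → (∀ d → ∑ₛ (λ G → 𝟙 (edge? (tail ∘ V) d W G)) ≡ ∏ (λ i → m i C d i)) →
    ∏ (λ i → m i C d i) + ∑ₛ (λ G → 𝟙 (edge? V d (inside ∷ W) (inside ∷ G))) ≡ ∏ (λ i → (𝟙 (zero ∈? V i) + m i) C d i)
  ∑ₛ-edge-inside d IH with d i₀ in d₀≡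
  ... | zero  = ∑ₛ-edge-inside-zero d d₀≡
  ... | suc e = begin
    ∏ (λ i → m i C d i) + ∑ₛ (λ G → 𝟙 (edge? V d (inside ∷ W) (inside ∷ G)))
      ≡⟨ cong (∏ (λ i → m i C d i) +_) (∑ₛ-edge-inside≡∑ₛ-edge-remaining d d₀≡) ⟩
    ∏ (λ i → m i C d i) + ∑ₛ (λ G → 𝟙 (edge? (tail ∘ V) (remaining V d) W G))
      ≡⟨ cong (∏ (λ i → m i C d i) +_) (IH (remaining V d)) ⟩
    ∏ (λ i → m i C d i) + ∏ (λ i → m i C remaining V d i)
      ≡⟨ ∏-C-pascal d d₀≡ ⟩
    ∏ (λ i → (𝟙 (zero ∈? V i) + m i) C d i)  ∎
    where open ≡-Reasoning

-- Induction on the ground set: the subsets G avoiding the point zero are counted by the recursive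
-- call, those containing it by the recursive call for the remaining demands (Pascal's rule).
∑ₛ-edge : ∀ {p N} {V : Fin p → Subset N} → PairwiseDisjoint V → ∀ {W} → Covered V W → ∀ d →
          ∑ₛ (λ G → 𝟙 (edge? V d W G)) ≡ ∏ (λ i → ∣ W ∩ V i ∣ C d i)
∑ₛ-edge {N = zero} {V} _ {[]} _ d = begin
  𝟙 (all? (λ i → ∣ [] ∩ V i ∣ ≟ d i)) ≡⟨ 𝟙-all? (λ i → ∣ [] ∩ V i ∣ ≟ d i) ⟩
  ∏ (λ i → 𝟙 (∣ [] ∩ V i ∣ ≟ d i))    ≡⟨ ∏-cong (λ i → subst (λ x → 𝟙 (x ≟ d i) ≡ x C d i) (sym (∣[]∩v∣≡0 (V i)))
                                                            (𝟙[0≟d]≡0Cd (d i))) ⟩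
  ∏ (λ i → ∣ [] ∩ V i ∣ C d i)         ∎
  where open ≡-Reasoning
∑ₛ-edge {N = suc N} {V} disjoint {w ∷ W} covered d = begin
  ∑ₛ (λ G → 𝟙 (edge? V d (w ∷ W) (outside ∷ G))) + ∑ₛ (λ G → 𝟙 (edge? V d (w ∷ W) (inside ∷ G)))
    ≡⟨ cong (_+ ∑ₛ (λ G → 𝟙 (edge? V d (w ∷ W) (inside ∷ G)))) (trans (∑ₛ-cong outside-edge) (IH d)) ⟩
  ∏ (λ i → m i C d i) + ∑ₛ (λ G → 𝟙 (edge? V d (w ∷ W) (inside ∷ G)))
    ≡⟨ inside-edges w covered ⟩
  ∏ (λ i → ∣ (w ∷ W) ∩ V i ∣ C d i) ∎
  where
  open ≡-Reasoning
  m : _ → ℕ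
  m i = ∣ W ∩ tail (V i) ∣
  IH : ∀ d → ∑ₛ (λ G → 𝟙 (edge? (tail ∘ V) d W G)) ≡ ∏ (λ i → m i C d i)
  IH = ∑ₛ-edge (PairwiseDisjoint-tail disjoint) (Covered-tail covered)
  outside-edge : ∀ G → 𝟙 (edge? V d (w ∷ W) (outside ∷ G)) ≡ 𝟙 (edge? (tail ∘ V) d W G)
  outside-edge G = 𝟙-⇔ (⇔.sym (out⊆-⇔ {s = w}) ×-⇔ ∀-⇔ (λ i → ≡-⇔ (∣outside∷∩∣ G (V i))))
                       (edge? V d (w ∷ W) (outside ∷ G)) (edge? (tail ∘ V) d W G)
  inside-edges : ∀ w → Covered V (w ∷ W) →
    ∏ (λ i → m i C d i) + ∑ₛ (λ G → 𝟙 (edge? V d (w ∷ W) (inside ∷ G))) ≡ ∏ (λ i → ∣ (w ∷ W) ∩ V i ∣ C d i)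
  inside-edges outside _ = begin
    ∏ (λ i → m i C d i) + ∑ₛ {N} (λ _ → 0)  ≡⟨ cong (∏ (λ i → m i C d i) +_) (∑ₛ-zero {N}) ⟩
    ∏ (λ i → m i C d i) + 0                 ≡⟨ +-identityʳ _ ⟩
    ∏ (λ i → m i C d i)                     ≡⟨ ∏-cong (λ i → cong (_C d i) (∣outside∷∩∣ W (V i))) ⟨
    ∏ (λ i → ∣ (outside ∷ W) ∩ V i ∣ C d i)  ∎
  inside-edges inside covered with covered zero here
  ... | i₀ , 0∈Vi₀ = trans (∑ₛ-edge-inside disjoint 0∈Vi₀ W d IH) (∏-cong (λ i → cong (_C d i) (sym (∣inside∷∩∣ W (V i)))))

module DoubleCounting {p N} (V : Fin p → Subset N) (k : Fin p → ℕ) (disjoint : PairwiseDisjoint V)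
                      (𝓕 : List (Subset N)) where

  sizes : Subset N → Fin p → ℕ
  sizes W i = ∣ W ∩ V i ∣

  shrink : (Fin p → ℕ) → Fin p → ℕ
  shrink m i = m i ∸ k i

  edgeCount : (Fin p → ℕ) → ℕ
  edgeCount m = ∏ (λ i → m i C k i)

  sequenceCount : (Fin p → ℕ) → ℕ → ℕ
  sequenceCount m zero    = 1
  sequenceCount m (suc t) = edgeCount m * sequenceCount (shrink m) t

  -- sequences W t counts the sequences of t pairwise disjoint edges inside W, and hits W t the
  -- pairs of such a sequence and a position in it holding a member of 𝓕.
  sequences : Subset N → ℕ → ℕ
  sequences W zero    = 1
  sequences W (suc t) = ∑ₛ (λ G → 𝟙 (edge? V k W G) * sequences (W ─ G) t)

  hits : Subset N → ℕ → ℕ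
  hits W zero    = 0
  hits W (suc t) = ∑ₛ (λ G → 𝟙 (edge? V k W G) * (𝟙 (G ∈ₗ? 𝓕) * sequences (W ─ G) t + hits (W ─ G) t))

  members : Subset N → ℕ
  members W = ∑ₛ (λ G → 𝟙 (edge? V k W G) * 𝟙 (G ∈ₗ? 𝓕))

  sizes-─ : ∀ {W G} → Edge V k W G → ∀ i → sizes (W ─ G) i ≡ shrink (sizes W) i
  sizes-─ {W} {G} (G⊆W , G-sizes) i = begin
    ∣ (W ─ G) ∩ V i ∣                      ≡⟨ m+n∸n≡m _ (k i) ⟨
    ∣ (W ─ G) ∩ V i ∣ + k i ∸ k i          ≡⟨ cong (λ x → ∣ (W ─ G) ∩ V i ∣ + x ∸ k i) (G-sizes i) ⟨
    ∣ (W ─ G) ∩ V i ∣ + ∣ G ∩ V i ∣ ∸ k i  ≡⟨ cong (_∸ k i) (∣─∩∣+∣∩∣ (V i) G⊆W) ⟩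
    ∣ W ∩ V i ∣ ∸ k i                      ∎
    where open ≡-Reasoning

  Covered-─ : ∀ {W} G → Covered V W → Covered V (W ─ G)
  Covered-─ {W} G = Covered-⊆ (p─q⊆p W G)

  edgeCount-cong : ∀ {m m′} → (∀ i → m i ≡ m′ i) → edgeCount m ≡ edgeCount m′
  edgeCount-cong m≗m′ = ∏-cong (λ i → cong (_C k i) (m≗m′ i))

  sequenceCount-cong : ∀ {m m′} t → (∀ i → m i ≡ m′ i) → sequenceCount m t ≡ sequenceCount m′ t
  sequenceCount-cong zero    m≗m′ = refl
  sequenceCount-cong (suc t) m≗m′ =
    cong₂ _*_ (edgeCount-cong m≗m′) (sequenceCount-cong t (λ i → cong (_∸ k i) (m≗m′ i)))

  sequenceCount-pos : ∀ t {m} → (∀ i → t * k i ≤ m i) → 0 < sequenceCount m t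
  sequenceCount-pos zero    _    = s≤s z≤n
  sequenceCount-pos (suc t) {m} room =
    *-mono-≤ (∏-pos _ (λ i → C-pos (m+n≤o⇒m≤o (k i) (room i))))
             (sequenceCount-pos t (λ i → m+n≤o⇒m≤o∸n (t * k i) (subst (_≤ m i) (+-comm (k i) (t * k i)) (room i))))

  sequences≡sequenceCount : ∀ {W} → Covered V W → ∀ t → sequences W t ≡ sequenceCount (sizes W) t
  sequences≡sequenceCount covered zero    = refl
  sequences≡sequenceCount {W} covered (suc t) = begin
    ∑ₛ (λ G → 𝟙 (edge? V k W G) * sequences (W ─ G) t)                 ≡⟨ ∑ₛ-cong remove ⟩
    ∑ₛ (λ G → 𝟙 (edge? V k W G) * sequenceCount (shrink (sizes W)) t)  ≡⟨ ∑ₛ-*ʳ (λ G → 𝟙 (edge? V k W G)) _ ⟩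
    ∑ₛ (λ G → 𝟙 (edge? V k W G)) * sequenceCount (shrink (sizes W)) t  ≡⟨ cong (_* sequenceCount (shrink (sizes W)) t)
                                                                                (∑ₛ-edge disjoint covered k) ⟩
    edgeCount (sizes W) * sequenceCount (shrink (sizes W)) t            ∎
    where
    open ≡-Reasoning
    remove : ∀ G → 𝟙 (edge? V k W G) * sequences (W ─ G) t ≡ 𝟙 (edge? V k W G) * sequenceCount (shrink (sizes W)) t
    remove G = 𝟙-*-cong (edge? V k W G) λ edge →
      trans (sequences≡sequenceCount (Covered-─ G covered) t) (sequenceCount-cong t (sizes-─ edge))

  swap-edges : ∀ {W G H} → Edge V k W G × Edge V k (W ─ G) H → Edge V k W H × Edge V k (W ─ H) G
  swap-edges ((G⊆W , G-sizes) , (H⊆W─G , H-sizes)) with Equivalence.to ⊆-─⇔ H⊆W─G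
  ... | H⊆W , G∩H=∅ = (H⊆W , H-sizes) , (Equivalence.from ⊆-─⇔ (G⊆W , Disjoint-sym G∩H=∅) , G-sizes)

  𝟙-edge-swap : ∀ W G H → 𝟙 (edge? V k W G) * 𝟙 (edge? V k (W ─ G) H) ≡ 𝟙 (edge? V k W H) * 𝟙 (edge? V k (W ─ H) G)
  𝟙-edge-swap W G H = begin
    𝟙 (edge? V k W G) * 𝟙 (edge? V k (W ─ G) H)  ≡⟨ 𝟙-×-dec (edge? V k W G) (edge? V k (W ─ G) H) ⟨
    𝟙 (edge? V k W G ×-dec edge? V k (W ─ G) H)  ≡⟨ 𝟙-⇔ (mk⇔ swap-edges swap-edges)
                                                        (edge? V k W G ×-dec edge? V k (W ─ G) H)
                                                        (edge? V k W H ×-dec edge? V k (W ─ H) G) ⟩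
    𝟙 (edge? V k W H ×-dec edge? V k (W ─ H) G)  ≡⟨ 𝟙-×-dec (edge? V k W H) (edge? V k (W ─ H) G) ⟩
    𝟙 (edge? V k W H) * 𝟙 (edge? V k (W ─ H) G)  ∎
    where open ≡-Reasoning

  -- Both sides count the pairs (G, H) of disjoint edges inside W with H ∈ 𝓕.
  ∑ₛ-members-─ : ∀ {W} → Covered V W →
                 ∑ₛ (λ G → 𝟙 (edge? V k W G) * members (W ─ G)) ≡ members W * edgeCount (shrink (sizes W))
  ∑ₛ-members-─ {W} covered = begin
    ∑ₛ (λ G → e W G * ∑ₛ (λ H → e (W ─ G) H * c H))        ≡⟨ ∑ₛ-cong (λ G → ∑ₛ-*ˡ (e W G) (λ H → e (W ─ G) H * c H)) ⟨
    ∑ₛ (λ G → ∑ₛ (λ H → e W G * (e (W ─ G) H * c H)))      ≡⟨ ∑ₛ-cong (λ G → ∑ₛ-cong (λ H → swap G H)) ⟩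
    ∑ₛ (λ G → ∑ₛ (λ H → e W H * (e (W ─ H) G * c H)))      ≡⟨ ∑ₛ-comm (λ G H → e W H * (e (W ─ H) G * c H)) ⟩
    ∑ₛ (λ H → ∑ₛ (λ G → e W H * (e (W ─ H) G * c H)))      ≡⟨ ∑ₛ-cong complete ⟩
    ∑ₛ (λ H → e W H * c H * edgeCount (shrink (sizes W)))  ≡⟨ ∑ₛ-*ʳ (λ H → e W H * c H) (edgeCount (shrink (sizes W))) ⟩
    members W * edgeCount (shrink (sizes W))               ∎
    where
    open ≡-Reasoning
    e : Subset N → Subset N → ℕ
    e W G = 𝟙 (edge? V k W G)
    c : Subset N → ℕ
    c G = 𝟙 (G ∈ₗ? 𝓕)
    swap : ∀ G H → e W G * (e (W ─ G) H * c H) ≡ e W H * (e (W ─ H) G * c H)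
    swap G H = trans (sym (*-assoc (e W G) _ _)) (trans (cong (_* c H) (𝟙-edge-swap W G H)) (*-assoc (e W H) _ _))
    complete : ∀ H → ∑ₛ (λ G → e W H * (e (W ─ H) G * c H)) ≡ e W H * c H * edgeCount (shrink (sizes W))
    complete H = begin
      ∑ₛ (λ G → e W H * (e (W ─ H) G * c H))        ≡⟨ ∑ₛ-*ˡ (e W H) (λ G → e (W ─ H) G * c H) ⟩
      e W H * ∑ₛ (λ G → e (W ─ H) G * c H)          ≡⟨ cong (e W H *_) (∑ₛ-*ʳ (e (W ─ H)) (c H)) ⟩
      e W H * (∑ₛ (e (W ─ H)) * c H)                ≡⟨ cong (λ x → e W H * (x * c H)) (∑ₛ-edge disjoint (Covered-─ H covered) k) ⟩
      e W H * (edgeCount (sizes (W ─ H)) * c H)     ≡⟨ 𝟙-*-cong (edge? V k W H) (λ edge → cong (_* c H) (edgeCount-cong (sizes-─ edge))) ⟩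
      e W H * (edgeCount (shrink (sizes W)) * c H)  ≡⟨ x∙yz≈xz∙y (e W H) _ (c H) ⟩
      e W H * c H * edgeCount (shrink (sizes W))    ∎

  ∑ₛ-hits-first : ∀ {W} → Covered V W → ∀ t →
    ∑ₛ (λ G → 𝟙 (edge? V k W G) * (𝟙 (G ∈ₗ? 𝓕) * sequences (W ─ G) t)) ≡ members W * sequenceCount (shrink (sizes W)) t
  ∑ₛ-hits-first {W} covered t = begin
    ∑ₛ (λ G → e G * (c G * sequences (W ─ G) t))  ≡⟨ ∑ₛ-cong (λ G → 𝟙-*-cong (edge? V k W G) λ edge →
                                                        cong (c G *_) (trans (sequences≡sequenceCount (Covered-─ G covered) t)
                                                                             (sequenceCount-cong t (sizes-─ edge)))) ⟩
    ∑ₛ (λ G → e G * (c G * q))                    ≡⟨ ∑ₛ-cong (λ G → *-assoc (e G) (c G) q) ⟨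
    ∑ₛ (λ G → e G * c G * q)                      ≡⟨ ∑ₛ-*ʳ (λ G → e G * c G) q ⟩
    members W * q                                 ∎
    where
    open ≡-Reasoning
    e : Subset N → ℕ
    e G = 𝟙 (edge? V k W G)
    c : Subset N → ℕ
    c G = 𝟙 (G ∈ₗ? 𝓕)
    q = sequenceCount (shrink (sizes W)) t

  hits-formula : ∀ {W} → Covered V W → ∀ t →
                 hits W (suc t) ≡ suc t * (members W * sequenceCount (shrink (sizes W)) t)
  hits-formula {W} covered t = begin
    ∑ₛ (λ G → e G * (c G * sequences (W ─ G) t + hits (W ─ G) t))
      ≡⟨ ∑ₛ-cong (λ G → *-distribˡ-+ (e G) _ _) ⟩
    ∑ₛ (λ G → e G * (c G * sequences (W ─ G) t) + e G * hits (W ─ G) t)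
      ≡⟨ ∑ₛ-distrib-+ (λ G → e G * (c G * sequences (W ─ G) t)) (λ G → e G * hits (W ─ G) t) ⟩
    ∑ₛ (λ G → e G * (c G * sequences (W ─ G) t)) + ∑ₛ (λ G → e G * hits (W ─ G) t)
      ≡⟨ cong₂ _+_ (∑ₛ-hits-first covered t) (later-hits t) ⟩
    members W * q t + t * (members W * q t)
      ∎
    where
    open ≡-Reasoning
    e : Subset N → ℕ
    e G = 𝟙 (edge? V k W G)
    c : Subset N → ℕ
    c G = 𝟙 (G ∈ₗ? 𝓕)
    q : ℕ → ℕ
    q = sequenceCount (shrink (sizes W))

    later-hits : ∀ u → ∑ₛ (λ G → e G * hits (W ─ G) u) ≡ u * (members W * q u)
    later-hits zero    = trans (∑ₛ-cong (λ G → *-zeroʳ (e G))) (∑ₛ-zero {N})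
    later-hits (suc u) = begin
      ∑ₛ (λ G → e G * hits (W ─ G) (suc u))                  ≡⟨ ∑ₛ-cong (λ G → 𝟙-*-cong (edge? V k W G) λ edge →
                                                                  trans (hits-formula (Covered-─ G covered) u)
                                                                        (cong (λ x → suc u * (members (W ─ G) * x))
                                                                              (sequenceCount-cong u (cong (_∸ k _) ∘ sizes-─ edge)))) ⟩
      ∑ₛ (λ G → e G * (suc u * (members (W ─ G) * r)))       ≡⟨ ∑ₛ-cong (λ G → pull-out (e G) (suc u) (members (W ─ G)) r) ⟩
      ∑ₛ (λ G → suc u * r * (e G * members (W ─ G)))         ≡⟨ ∑ₛ-*ˡ (suc u * r) (λ G → e G * members (W ─ G)) ⟩
      suc u * r * ∑ₛ (λ G → e G * members (W ─ G))           ≡⟨ cong (suc u * r *_) (∑ₛ-members-─ covered) ⟩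
      suc u * r * (members W * edgeCount (shrink (sizes W))) ≡⟨ push-in (suc u) r (members W) (edgeCount (shrink (sizes W))) ⟩
      suc u * (members W * q (suc u))                        ∎
      where
      r = sequenceCount (shrink (shrink (sizes W))) u
      pull-out : ∀ e a f r → e * (a * (f * r)) ≡ a * r * (e * f)
      pull-out = solve-∀
      push-in : ∀ a r f h → a * r * (f * h) ≡ a * (f * (h * r))
      push-in = solve-∀

  MatchingNumberWithin : Subset N → ℕ → Set
  MatchingNumberWithin W s = ∀ M → IsMatching 𝓕 M → All (_⊆ W) M → length M ≤ s

  module _ {i₀} (k₀>0 : 0 < k i₀) where

    edge-nonempty : ∀ {W G} → Edge V k W G → ¬ Disjoint G G
    edge-nonempty {G = G} (_ , G-sizes) G∩G=∅ = <⇒≢ k₀>0 (begin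
      0                 ≡⟨ ∣⊥∣≡0 N ⟨
      ∣ ⊥ {N} ∣         ≡⟨ cong ∣_∣ (Empty-unique G∩Vi₀=∅) ⟨
      ∣ G ∩ V i₀ ∣      ≡⟨ G-sizes i₀ ⟩
      k i₀              ∎)
      where
      open ≡-Reasoning
      G∩Vi₀=∅ : Empty (G ∩ V i₀)
      G∩Vi₀=∅ (x , x∈G∩Vi₀) = let x∈G = proj₁ (x∈p∩q⁻ G (V i₀) x∈G∩Vi₀) in G∩G=∅ (x , x∈p∩q⁺ (x∈G , x∈G))

    extend-matching : ∀ {W G M} → Edge V k W G → G ∈ₗ 𝓕 → IsMatching 𝓕 M → All (_⊆ W ─ G) M →
                      IsMatching 𝓕 (G ∷ M) × All (_⊆ W) (G ∷ M)
    extend-matching {W} {G} edge G∈𝓕 (M⊆𝓕 , M-unique , M-disjoint) M⊆W─G =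
      (G∈𝓕 ∷ M⊆𝓕 , All.map G≢ M⊆W─G ∷ M-unique , All.map (proj₂ ∘ split) M⊆W─G ∷ M-disjoint) ,
      (proj₁ edge ∷ All.map (proj₁ ∘ split) M⊆W─G)
      where
      split : ∀ {H} → H ⊆ W ─ G → H ⊆ W × Disjoint G H
      split = Equivalence.to ⊆-─⇔
      G≢ : ∀ {H} → H ⊆ W ─ G → G ≢ H
      G≢ H⊆W─G refl = edge-nonempty edge (proj₂ (split H⊆W─G))

    -- The members of 𝓕 in one sequence form a matching inside W.
    hits-bound : ∀ t {W s} → MatchingNumberWithin W s → hits W t ≤ s * sequences W t
    hits-bound zero          _   = z≤n
    hits-bound (suc t) {W} {s} ν≤s = begin
      ∑ₛ (λ G → e G * (𝟙 (G ∈ₗ? 𝓕) * sequences (W ─ G) t + hits (W ─ G) t))  ≤⟨ ∑ₛ-mono-≤ bound ⟩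
      ∑ₛ (λ G → s * (e G * sequences (W ─ G) t))                             ≡⟨ ∑ₛ-*ˡ s (λ G → e G * sequences (W ─ G) t) ⟩
      s * sequences W (suc t)                                                ∎
      where
      open ≤-Reasoning
      e : Subset N → ℕ
      e G = 𝟙 (edge? V k W G)
      restrict : ∀ {G s} → MatchingNumberWithin W s → MatchingNumberWithin (W ─ G) s
      restrict {G} ν≤s M matching M⊆W─G = ν≤s M matching (All.map (λ H⊆W─G {x} x∈H → p─q⊆p W G (H⊆W─G x∈H)) M⊆W─G)
      step : ∀ {G} → Edge V k W G → ∀ s → MatchingNumberWithin W s → (G∈? : Dec (G ∈ₗ 𝓕)) →
             𝟙 G∈? * sequences (W ─ G) t + hits (W ─ G) t ≤ s * sequences (W ─ G) t
      step edge s       ν≤s (no _)    = hits-bound t (restrict ν≤s)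
      step edge zero    ν≤s (yes G∈𝓕) with () ← uncurry (ν≤s (_ ∷ [])) (extend-matching edge G∈𝓕 ([] , [] , []) [])
      step edge (suc s) ν≤s (yes G∈𝓕) = +-mono-≤ (≤-reflexive (*-identityˡ _)) (hits-bound t ν≤s-after-G)
        where
        ν≤s-after-G : MatchingNumberWithin (W ─ _) s
        ν≤s-after-G M matching M⊆W─G = s≤s⁻¹ (uncurry (ν≤s (_ ∷ M)) (extend-matching edge G∈𝓕 matching M⊆W─G))
      bound : ∀ G → e G * (𝟙 (G ∈ₗ? 𝓕) * sequences (W ─ G) t + hits (W ─ G) t) ≤ s * (e G * sequences (W ─ G) t)
      bound G = ≤-trans (𝟙-*-mono (edge? V k W G) (λ edge → step edge s ν≤s (G ∈ₗ? 𝓕)))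
                        (≤-reflexive (x∙yz≈y∙xz (e G) s (sequences (W ─ G) t)))

  members-⋃ᶠ : Unique 𝓕 → All (InDirectProduct V k) 𝓕 → members (⋃ᶠ V) ≡ length 𝓕
  members-⋃ᶠ unique 𝓕⊆V = trans (∑ₛ-cong 𝟙-edge*𝟙-∈≡𝟙-∈) (∑ₛ-𝟙-∈ 𝓕 unique)
    where
    𝟙-edge*𝟙-∈≡𝟙-∈ : ∀ G → 𝟙 (edge? V k (⋃ᶠ V) G) * 𝟙 (G ∈ₗ? 𝓕) ≡ 𝟙 (G ∈ₗ? 𝓕)
    𝟙-edge*𝟙-∈≡𝟙-∈ G with G ∈ₗ? 𝓕
    ... | no _    = *-zeroʳ (𝟙 (edge? V k (⋃ᶠ V) G))
    ... | yes G∈𝓕 = let covered , G-sizes = All.lookup 𝓕⊆V G∈𝓕 in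
                    cong (_* 1) (𝟙-yes (edge? V k (⋃ᶠ V) G) (Covered⇒⊆⋃ᶠ V covered , G-sizes))

  averaging : ∀ {i₀} → 0 < k i₀ → Unique 𝓕 → All (InDirectProduct V k) 𝓕 → ∀ s t → MatchingNumberAtMost 𝓕 s →
              (∀ i → t * k i ≤ ∣ V i ∣) → t * length 𝓕 ≤ s * ∏ (λ i → ∣ V i ∣ C k i)
  averaging k₀>0 unique 𝓕⊆V s zero    ν≤s room = z≤n
  averaging k₀>0 unique 𝓕⊆V s (suc t) ν≤s room =
    *-cancelʳ-≤ (suc t * length 𝓕) (s * ∏ (λ i → ∣ V i ∣ C k i)) q {{>-nonZero q>0}} (begin
      suc t * length 𝓕 * q               ≡⟨ *-assoc (suc t) (length 𝓕) q ⟩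
      suc t * (length 𝓕 * q)             ≡⟨ cong (λ f → suc t * (f * q)) (members-⋃ᶠ unique 𝓕⊆V) ⟨
      suc t * (members U * q)            ≡⟨ hits-formula (Covered-⋃ᶠ V) t ⟨
      hits U (suc t)                     ≤⟨ hits-bound k₀>0 (suc t) (λ M matching _ → ν≤s M matching) ⟩
      s * sequences U (suc t)            ≡⟨ cong (s *_) (sequences≡sequenceCount (Covered-⋃ᶠ V) (suc t)) ⟩
      s * (edgeCount (sizes U) * q)      ≡⟨ cong (λ e → s * (e * q)) (edgeCount-cong sizes-U) ⟩
      s * (∏ (λ i → ∣ V i ∣ C k i) * q)  ≡⟨ *-assoc s _ q ⟨
      s * ∏ (λ i → ∣ V i ∣ C k i) * q    ∎)
    where
    open ≤-Reasoning
    U = ⋃ᶠ V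
    q = sequenceCount (shrink (sizes U)) t
    sizes-U : ∀ i → sizes U i ≡ ∣ V i ∣
    sizes-U i = cong ∣_∣ (⋃ᶠ-∩ V i)
    q>0 : 0 < q
    q>0 = sequenceCount-pos t (λ i → m+n≤o⇒m≤o∸n (t * k i) (subst₂ _≤_ (+-comm (k i) (t * k i)) (sym (sizes-U i)) (room i)))

m/n*o≤p : ∀ {m n o p} .{{_ : NonZero n}} → m * o ≤ p * n → m / n * o ≤ p
m/n*o≤p {m} {n} {o} {p} mo≤pn = *-cancelʳ-≤ (m / n * o) p n (begin
  m / n * o * n  ≡⟨ xy∙z≈xz∙y (m / n) o n ⟩
  m / n * n * o  ≤⟨ *-monoˡ-≤ o (m/n*n≤m m n) ⟩
  m * o          ≤⟨ mo≤pn ⟩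
  p * n          ∎)
  where open ≤-Reasoning

s*n≤[1+s]*k*[n/k] : ∀ {n k s} .{{_ : NonZero k}} → s < n / k → s * n ≤ suc s * k * (n / k)
s*n≤[1+s]*k*[n/k] {n} {k} {s} s<q = begin
  s * n                      ≡⟨ cong (s *_) (m≡m%n+[m/n]*n n k) ⟩
  s * (n % k + q * k)        ≡⟨ *-distribˡ-+ s (n % k) (q * k) ⟩
  s * (n % k) + s * (q * k)  ≤⟨ +-monoˡ-≤ (s * (q * k)) (*-mono-≤ (<⇒≤ s<q) (<⇒≤ (m%n<n n k))) ⟩
  q * k + s * (q * k)        ≡⟨ regroup q k s ⟩
  suc s * k * q              ∎
  where
  open ≤-Reasoning
  q = n / k
  regroup : ∀ q k s → q * k + s * (q * k) ≡ suc s * k * q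
  regroup = solve-∀

floor-averaging : ∀ {n k s L P} .{{_ : NonZero k}} → suc s * k ≤ n → n / k * L ≤ s * P → n * L ≤ suc s * k * P
floor-averaging {n} {k} {s} {L} {P} [1+s]k≤n qL≤sP = *-cancelʳ-≤ (n * L) (suc s * k * P) q {{>-nonZero q>0}} (begin
  n * L * q          ≡⟨ *-assoc n L q ⟩
  n * (L * q)        ≡⟨ cong (n *_) (*-comm L q) ⟩
  n * (q * L)        ≤⟨ *-monoʳ-≤ n qL≤sP ⟩
  n * (s * P)        ≡⟨ *-assoc n s P ⟨
  n * s * P          ≡⟨ cong (_* P) (*-comm n s) ⟩
  s * n * P          ≤⟨ *-monoˡ-≤ P (s*n≤[1+s]*k*[n/k] s<q) ⟩
  suc s * k * q * P  ≡⟨ xy∙z≈xz∙y (suc s * k) q P ⟩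
  suc s * k * P * q  ∎)
  where
  open ≤-Reasoning
  q = n / k
  s<q : s < q
  s<q = subst (_≤ q) (m*n/n≡m (suc s) k) (/-monoˡ-≤ k [1+s]k≤n)
  q>0 : 0 < q
  q>0 = ≤-trans (s≤s z≤n) s<q

lemma2p2 : (l s N : ℕ) → 1 ≤ s →
    (n k : Fin (suc l) → ℕ) →
    (∀ i → 1 ≤ n i) → (∀ i → 1 ≤ k i) →
    (suc s * k zero ≤ n zero) →
    (∀ i j → i ≤ᶠ j → n i * k j ≤ n j * k i) →
    (V : Fin (suc l) → Subset N) → PairwiseDisjoint V → (∀ i → ∣ V i ∣ ≡ n i) →
    (𝓕 : List (Subset N)) → Unique 𝓕 → All (InDirectProduct V k) 𝓕 →
    MatchingNumberAtMost 𝓕 s →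
    n zero * length 𝓕 ≤ suc s * k zero * ∏ (λ i → n i C k i)
lemma2p2 l s N _ n k _ k>0 [1+s]k₀≤n₀ ratios-sorted V disjoint ∣V∣≡n 𝓕 unique 𝓕⊆V ν≤s =
  floor-averaging {s = s} [1+s]k₀≤n₀ (subst (λ P → t * length 𝓕 ≤ s * P) (∏-cong (λ i → cong (_C k i) (∣V∣≡n i))) averaged)
  where
  open DoubleCounting V k disjoint 𝓕
  instance
    k₀≢0 : NonZero (k zero)
    k₀≢0 = >-nonZero (k>0 zero)
  t = n zero / k zero
  room : ∀ i → t * k i ≤ ∣ V i ∣
  room i = subst (t * k i ≤_) (sym (∣V∣≡n i)) (m/n*o≤p (ratios-sorted zero i z≤n))
  averaged : t * length 𝓕 ≤ s * ∏ (λ i → ∣ V i ∣ C k i)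
  averaged = averaging (k>0 zero) unique 𝓕⊆V s t ν≤s room
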